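{- Let $\beta<\mathfrak{b}$ and let $(\mathcal{A}_\alpha)_{\alpha<\beta}$ be an increasing (with respect to inclusion) sequence of families of subsets of $\omega$ such that no $\mathcal{A}_\alpha$ is an external quasi-subbase of any contour. Then $\bigcup_{\alpha<\beta}\mathcal{A}_\alpha$ is not an external quasi-subbase of any contour.
   Context: $\mathfrak{b}$ is the bounding number: the least cardinality of a family of functions in $\omega^\omega$ not dominated by a single function (i.e. there is no $g$ with $f(n)\le g(n)$ for almost all $n$ for every $f$ in the family). A family of sets has the strong finite intersection property (sfip) if every finite subfamily has infinite intersection; for such a family $\mathcal{A}$, $\langle\mathcal{A}\rangle$ is the filter it generates. For a partition $\mathcal{W}=\{W_n:n<\omega\}$ of a subset of $\omega$ into infinite pairwise disjoint sets, the contour $\int\mathcal{W}$ is the filter of all $W\subseteq\omega$ for which there is a cofinite $I\subseteq\omega$ such that $W\cap W_n$ is cofinite in $W_n$ for every $n\in I$; a contour is a filter of this form. A family $\mathcal{A}$ is an external quasi-subbase (EQ-subbase) of a filter $\mathcal{F}$ if there is a countable family $\mathcal{B}$ such that $\mathcal{A}\cup\mathcal{B}$ has the sfip and $\mathcal{F}\subseteq\langle\mathcal{A}\cup\mathcal{B}\rangle$. -}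

module Defs where

import Level
open import Level using (0ℓ; Lift)
open import Data.Unit using (⊤)
open import Data.Sum using (_⊎_)
open import Data.Nat using (ℕ; _≤_)
open import Data.Product using (Σ; ∃; _×_; _,_)
open import Data.List using (List; []; _∷_)
open import Data.List.Relation.Unary.All using (All)
open import Relation.Binary.PropositionalEquality using (_≢_)
open import Relation.Nullary using (¬_)
open import Induction.WellFounded using (WellFounded)
open import Relation.Binary.Structures using (IsStrictTotalOrder)
open import Relation.Binary.PropositionalEquality using (_≡_)

Subset : Set₁
Subset = ℕ → Set

Family : Set₂
Family = Subset → Set₁

_⊆_ : Subset → Subset → Set
X ⊆ Y = ∀ n → X n → Y n

_⊆F_ : Family → Family → Set₁
𝒜 ⊆F 𝒞 = ∀ X → 𝒜 X → 𝒞 X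

Infinite : Subset → Set
Infinite X = ∀ n → ∃ λ m → n ≤ m × X m

-- intersection of a finite list of subsets (empty list gives ω)
⋂ : List Subset → Subset
⋂ [] n = ⊤
⋂ (X ∷ Xs) n = X n × ⋂ Xs n

SFIP : Family → Set₁
SFIP 𝒜 = ∀ (Xs : List Subset) → All 𝒜 Xs → Infinite (⋂ Xs)

⟨_⟩ : Family → Family
⟨ 𝒜 ⟩ X = Σ (List Subset) λ Xs → All 𝒜 Xs × (⋂ Xs ⊆ X)

_∪F_ : Family → Family → Family
(𝒜 ∪F 𝒞) X = 𝒜 X ⊎ 𝒞 X

IsPartition : (ℕ → Subset) → Set
IsPartition W = (∀ n → Infinite (W n))
              × (∀ n k → n ≢ k → ∀ m → ¬ (W n m × W k m))

CofiniteIn : Subset → Subset → Set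
CofiniteIn X Y = ∃ λ N → ∀ m → N ≤ m → Y m → X m

∫ : (ℕ → Subset) → Family
∫ W X = Lift (Level.suc 0ℓ) (∃ λ N → ∀ n → N ≤ n → CofiniteIn X (W n))

Range : (ℕ → Subset) → Family
Range e X = ∃ λ n → e n ≡ X

EQSubbase : Family → Family → Set₁
EQSubbase 𝒜 ℱ = Σ (ℕ → Subset) λ e →
  SFIP (𝒜 ∪F Range e) × (ℱ ⊆F ⟨ 𝒜 ∪F Range e ⟩)

EQSubbaseOfContour : Family → Set₁
EQSubbaseOfContour 𝒜 = Σ (ℕ → Subset) λ W → IsPartition W × EQSubbase 𝒜 (∫ W)

_≤*_ : (ℕ → ℕ) → (ℕ → ℕ) → Set
f ≤* g = ∃ λ N → ∀ n → N ≤ n → f n ≤ g n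

-- |I| < 𝔟 : every I-indexed family in ω^ω is dominated by a single function
BelowB : Set → Set
BelowB I = ∀ (f : I → ℕ → ℕ) → ∃ λ g → ∀ i → f i ≤* g

record Ordinal : Set₁ where
  field
    Carrier : Set
    _<_ : Carrier → Carrier → Set
    isSTO : IsStrictTotalOrder _≡_ _<_
    wf : WellFounded _<_

-- Enlarge the countable family by the tails ⋃_{n ≥ k} W n; they lie in the filter, so the sfip
-- survives. By hypothesis each stage α, with this countable family, misses some X α ∈ ∫W, and X α
-- contains W n from some point f α n on, for almost all n. Fewer than 𝔟 stages means one g dominates
-- every f α. Let Y consist of the points lying beyond g on their block, minus one chosen point of
-- each finite intersection of the countable family; Y ∈ ∫W since each block loses only finitely
-- many points. A finite generator of Y lies in a single stage α (the family is a chain) or is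
-- purely countable; the chosen points exclude the latter, and in the former case intersecting with
-- a far enough tail yields a generator of X α.
module Submission where

open import Defs
open import Level using (0ℓ; suc; lift)
open import Axiom.ExcludedMiddle using (ExcludedMiddle)
open import Axiom.DoubleNegationElimination using (em⇒dne)
open import Data.Nat using (ℕ; zero; _≤_; _≤?_; _≟_; _⊔_; z≤n; s≤s) renaming (suc to 1+)
open import Data.Nat.Properties
  using (≤-refl; ≤-trans; n≤1+n; m≤n⇒m<n∨m≡n; m≤m⊔n; m≤n⊔m; <-irrefl)
open import Data.Product using (Σ; ∃; _×_; _,_; proj₁; proj₂)
open import Data.Sum using (_⊎_; inj₁; inj₂)
import Data.Sum as Sum
open import Data.List using (List; []; _∷_; _++_)
open import Data.List.Relation.Unary.All using (All; []; _∷_)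
import Data.List.Relation.Unary.All as All
open import Data.List.Relation.Unary.All.Properties using (++⁺)
open import Data.Empty using (⊥; ⊥-elim)
open import Data.Unit using (tt)
open import Function using (_∘_)
open import Relation.Nullary using (¬_; yes; no)
open import Relation.Binary.PropositionalEquality using (_≡_; _≢_; refl; sym; trans; subst)
open import Relation.Binary.Definitions using (tri<; tri≈; tri>)
open import Relation.Binary.Structures using (IsStrictTotalOrder)

⋃ : {I : Set} → (I → Family) → Family
⋃ 𝒜 X = ∃ λ α → 𝒜 α X

_∩_ : Subset → Subset → Subset
(X ∩ Y) m = X m × Y m

All-⊆F : ∀ {𝒜 𝒞} → 𝒜 ⊆F 𝒞 → ∀ {Xs} → All 𝒜 Xs → All 𝒞 Xs
All-⊆F 𝒜⊆𝒞 = All.map (𝒜⊆𝒞 _)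

¬⊆F⇒witness : ExcludedMiddle (suc 0ℓ) → ∀ {𝒜 𝒞} → ¬ (𝒜 ⊆F 𝒞) → Σ Subset λ X → 𝒜 X × ¬ 𝒞 X
¬⊆F⇒witness em 𝒜⊈𝒞 = dne λ noWitness → 𝒜⊈𝒞 λ X X∈𝒜 → dne λ X∉𝒞 → noWitness (X , X∈𝒜 , X∉𝒞)
  where dne = em⇒dne em

⋂-++⁻ : ∀ Xs Ys → ⋂ (Xs ++ Ys) ⊆ (⋂ Xs ∩ ⋂ Ys)
⋂-++⁻ [] Ys m m∈ = tt , m∈
⋂-++⁻ (X ∷ Xs) Ys m (m∈X , m∈rest) =
  let (m∈Xs , m∈Ys) = ⋂-++⁻ Xs Ys m m∈rest in (m∈X , m∈Xs) , m∈Ys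

module _ {𝒜 : Family} where

  ⟨⟩-base : ∀ {X} → 𝒜 X → ⟨ 𝒜 ⟩ X
  ⟨⟩-base X∈𝒜 = _ ∷ [] , X∈𝒜 ∷ [] , λ _ → proj₁

  ⟨⟩-∩ : ∀ {X Y} → ⟨ 𝒜 ⟩ X → ⟨ 𝒜 ⟩ Y → ⟨ 𝒜 ⟩ (X ∩ Y)
  ⟨⟩-∩ (Xs , Xs∈ , ⋂Xs⊆X) (Ys , Ys∈ , ⋂Ys⊆Y) =
    Xs ++ Ys , ++⁺ Xs∈ Ys∈ ,
    λ m m∈ → let (m∈Xs , m∈Ys) = ⋂-++⁻ Xs Ys m m∈ in ⋂Xs⊆X m m∈Xs , ⋂Ys⊆Y m m∈Ys

  ⟨⟩-⋂ : ∀ {𝒞} → 𝒞 ⊆F ⟨ 𝒜 ⟩ → ∀ {Xs} → All (𝒜 ∪F 𝒞) Xs → ⟨ 𝒜 ⟩ (⋂ Xs)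
  ⟨⟩-⋂ 𝒞⊆ [] = [] , [] , λ _ _ → tt
  ⟨⟩-⋂ 𝒞⊆ (inj₁ X∈𝒜 ∷ Xs∈) = ⟨⟩-∩ (⟨⟩-base X∈𝒜) (⟨⟩-⋂ 𝒞⊆ Xs∈)
  ⟨⟩-⋂ 𝒞⊆ (inj₂ X∈𝒞 ∷ Xs∈) = ⟨⟩-∩ (𝒞⊆ _ X∈𝒞) (⟨⟩-⋂ 𝒞⊆ Xs∈)

  SFIP⇒⟨⟩-infinite : SFIP 𝒜 → ∀ {X} → ⟨ 𝒜 ⟩ X → Infinite X
  SFIP⇒⟨⟩-infinite sfip (Xs , Xs∈ , ⋂Xs⊆X) n =
    let (m , n≤m , m∈) = sfip Xs Xs∈ n in m , n≤m , ⋂Xs⊆X m m∈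

  SFIP-antitone : ∀ {𝒞} → 𝒜 ⊆F 𝒞 → SFIP 𝒞 → SFIP 𝒜
  SFIP-antitone 𝒜⊆𝒞 sfip Xs Xs∈ = sfip Xs (All-⊆F 𝒜⊆𝒞 Xs∈)

  SFIP-∪ : ∀ {𝒞} → 𝒞 ⊆F ⟨ 𝒜 ⟩ → SFIP 𝒜 → SFIP (𝒜 ∪F 𝒞)
  SFIP-∪ 𝒞⊆ sfip Xs Xs∈ = SFIP⇒⟨⟩-infinite sfip (⟨⟩-⋂ 𝒞⊆ Xs∈)

double : ℕ → ℕ
double zero = zero
double (1+ n) = 1+ (1+ (double n))

n≤double : ∀ n → n ≤ double n
n≤double zero = z≤n
n≤double (1+ n) = s≤s (≤-trans (n≤double n) (n≤1+n _))

module _ {ℓ} {A : Set ℓ} where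

  interleave : (ℕ → A) → (ℕ → A) → ℕ → A
  interleave a b zero = a 0
  interleave a b (1+ zero) = b 0
  interleave a b (1+ (1+ n)) = interleave (a ∘ 1+) (b ∘ 1+) n

  interleave-double : ∀ a b k → interleave a b (double k) ≡ a k
  interleave-double a b zero = refl
  interleave-double a b (1+ k) = interleave-double (a ∘ 1+) (b ∘ 1+) k

  interleave-1+double : ∀ a b k → interleave a b (1+ (double k)) ≡ b k
  interleave-1+double a b zero = refl
  interleave-1+double a b (1+ k) = interleave-1+double (a ∘ 1+) (b ∘ 1+) k

  interleave-cases : ∀ a b i →
    (∃ λ k → interleave a b i ≡ a k) ⊎ (∃ λ k → interleave a b i ≡ b k)
  interleave-cases a b zero = inj₁ (0 , refl)
  interleave-cases a b (1+ zero) = inj₂ (0 , refl)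
  interleave-cases a b (1+ (1+ n)) =
    Sum.map (λ (k , eq) → 1+ k , eq) (λ (k , eq) → 1+ k , eq) (interleave-cases (a ∘ 1+) (b ∘ 1+) n)

Range-interleave⁻ : ∀ a b → Range (interleave a b) ⊆F (Range a ∪F Range b)
Range-interleave⁻ a b X (i , eq) =
  Sum.map (λ (k , ≡a) → k , trans (sym ≡a) eq) (λ (k , ≡b) → k , trans (sym ≡b) eq)
          (interleave-cases a b i)

Range-interleaveˡ : ∀ a b → Range a ⊆F Range (interleave a b)
Range-interleaveˡ a b X (k , eq) = double k , trans (interleave-double a b k) eq

Range-interleaveʳ : ∀ a b → Range b ⊆F Range (interleave a b)
Range-interleaveʳ a b X (k , eq) = 1+ (double k) , trans (interleave-1+double a b k) eq

⋂≤ : (ℕ → Subset) → ℕ → Subset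
⋂≤ c j m = ∀ i → i ≤ j → c i m

⋂≤-antitone : ∀ c {i j} → i ≤ j → ⋂≤ c j ⊆ ⋂≤ c i
⋂≤-antitone c i≤j m m∈ k k≤i = m∈ k (≤-trans k≤i i≤j)

prefix : (ℕ → Subset) → ℕ → List Subset
prefix c zero = c 0 ∷ []
prefix c (1+ j) = c (1+ j) ∷ prefix c j

All-Range-prefix : ∀ c j → All (Range c) (prefix c j)
All-Range-prefix c zero = (0 , refl) ∷ []
All-Range-prefix c (1+ j) = (1+ j , refl) ∷ All-Range-prefix c j

⋂-prefix : ∀ c j → ⋂ (prefix c j) ⊆ ⋂≤ c j
⋂-prefix c zero m (m∈c₀ , _) zero _ = m∈c₀
⋂-prefix c (1+ j) m (m∈cⱼ , m∈rest) i i≤1+j with m≤n⇒m<n∨m≡n i≤1+j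
... | inj₂ refl = m∈cⱼ
... | inj₁ (s≤s i≤j) = ⋂-prefix c j m m∈rest i i≤j

⋂≤-nonempty : ∀ {c} → SFIP (Range c) → ∀ j → ∃ (⋂≤ c j)
⋂≤-nonempty {c} sfip j =
  let (m , _ , m∈) = sfip (prefix c j) (All-Range-prefix c j) 0 in m , ⋂-prefix c j m m∈

All-Range⇒⋂≤ : ∀ {c Xs} → All (Range c) Xs → ∃ λ j → ⋂≤ c j ⊆ ⋂ Xs
All-Range⇒⋂≤ [] = 0 , λ _ _ → tt
All-Range⇒⋂≤ {c} ((i , refl) ∷ Xs∈) =
  let (j , ⋂≤⊆) = All-Range⇒⋂≤ Xs∈
  in i ⊔ j , λ m m∈ → m∈ i (m≤m⊔n i j) , ⋂≤⊆ m (⋂≤-antitone c (m≤n⊔m i j) m m∈)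

max≤ : (ℕ → ℕ) → ℕ → ℕ
max≤ q zero = q 0
max≤ q (1+ n) = q (1+ n) ⊔ max≤ q n

≤-max≤ : ∀ q {k n} → k ≤ n → q k ≤ max≤ q n
≤-max≤ q {n = zero} z≤n = ≤-refl
≤-max≤ q {n = 1+ n} k≤1+n with m≤n⇒m<n∨m≡n k≤1+n
... | inj₂ refl = m≤m⊔n (q (1+ n)) (max≤ q n)
... | inj₁ (s≤s k≤n) = ≤-trans (≤-max≤ q k≤n) (m≤n⊔m (q (1+ n)) (max≤ q n))

tail : (ℕ → Subset) → ℕ → Subset
tail W k m = ∃ λ n → k ≤ n × W n m

Above : (ℕ → Subset) → (ℕ → ℕ) → Subset
Above W g m = ∀ n → W n m → g n ≤ m

Missed : (ℕ → ℕ) → Subset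
Missed q m = ∀ k → q k ≢ m

Threshold : (ℕ → Subset) → Subset → ℕ → (ℕ → ℕ) → Set
Threshold W X N f = ∀ n → N ≤ n → ∀ m → f n ≤ m → W n m → X m

module _ {W : ℕ → Subset} where

  tail∈∫ : ∀ k → ∫ W (tail W k)
  tail∈∫ k = lift (k , λ n k≤n → 0 , λ m _ m∈Wₙ → n , k≤n , m∈Wₙ)

  ∫-threshold : ∀ {X} → ∫ W X → ∃ λ N → Σ (ℕ → ℕ) λ f → Threshold W X N f
  ∫-threshold {X} (lift (N , cofinite)) = N , f , threshold
    where
    f : ℕ → ℕ
    f n with N ≤? n
    ... | yes N≤n = proj₁ (cofinite n N≤n)
    ... | no _ = 0
    threshold : Threshold W X N f
    threshold n N≤n m with N ≤? n
    ... | yes N≤n′ = proj₂ (cofinite n N≤n′) m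
    ... | no N≰n = ⊥-elim (N≰n N≤n)

  Threshold-capture : ∀ {X N f g} → Threshold W X N f → f ≤* g →
    ∃ λ K → (tail W K ∩ Above W g) ⊆ X
  Threshold-capture {N = N} threshold (M , f≤g) =
    N ⊔ M , λ { m ((n , K≤n , m∈Wₙ) , above) →
      threshold n (≤-trans (m≤m⊔n N M) K≤n) m
        (≤-trans (f≤g n (≤-trans (m≤n⊔m N M) K≤n)) (above n m∈Wₙ)) m∈Wₙ }

  same-block : IsPartition W → ∀ {n n′ m} → W n m → W n′ m → n ≡ n′
  same-block (_ , disjoint) {n} {n′} {m} m∈Wₙ m∈Wₙ′ with n ≟ n′
  ... | yes n≡n′ = n≡n′
  ... | no n≢n′ = ⊥-elim (disjoint n n′ n≢n′ m (m∈Wₙ , m∈Wₙ′))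

  -- q k can lie in W n only for k ≤ n, so each block meets the range of q in a finite set.
  Above∩Missed∈∫ : IsPartition W → ∀ g q → (∀ k → tail W k (q k)) → ∫ W (Above W g ∩ Missed q)
  Above∩Missed∈∫ partition g q q∈tail =
    lift (0 , λ n _ → g n ⊔ 1+ (max≤ q n) , λ m K≤m m∈Wₙ → above n m K≤m m∈Wₙ , missed n m K≤m m∈Wₙ)
    where
    above : ∀ n m → g n ⊔ 1+ (max≤ q n) ≤ m → W n m → Above W g m
    above n m K≤m m∈Wₙ n′ m∈Wₙ′ with same-block partition m∈Wₙ m∈Wₙ′
    ... | refl = ≤-trans (m≤m⊔n (g n) _) K≤m
    missed : ∀ n m → g n ⊔ 1+ (max≤ q n) ≤ m → W n m → Missed q m
    missed n m K≤m m∈Wₙ k refl with k ≤? n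
    ... | yes k≤n = <-irrefl refl (≤-trans (s≤s (≤-max≤ q k≤n)) (≤-trans (m≤n⊔m (g n) _) K≤m))
    ... | no k≰n with q∈tail k
    ...   | n′ , k≤n′ , m∈Wₙ′ with same-block partition m∈Wₙ m∈Wₙ′
    ...     | refl = k≰n k≤n′

Directed : {I : Set} → (I → Family) → Set₁
Directed 𝒜 = ∀ α α′ → ∃ λ γ → 𝒜 α ⊆F 𝒜 γ × 𝒜 α′ ⊆F 𝒜 γ

chain-directed : (β : Ordinal) (𝒜 : Ordinal.Carrier β → Family) →
  (∀ α α′ → Ordinal._<_ β α α′ → 𝒜 α ⊆F 𝒜 α′) → Directed 𝒜
chain-directed β 𝒜 mono α α′ with IsStrictTotalOrder.compare (Ordinal.isSTO β) α α′
... | tri< α<α′ _ _ = α′ , mono α α′ α<α′ , λ _ X∈ → X∈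
... | tri≈ _ refl _ = α , (λ _ X∈ → X∈) , λ _ X∈ → X∈
... | tri> _ _ α′<α = α , (λ _ X∈ → X∈) , mono α′ α α′<α

All-⋃-directed : ∀ {I} {𝒜 : I → Family} {ℬ} → Directed 𝒜 → ∀ {Xs} →
  All (⋃ 𝒜 ∪F ℬ) Xs → (∃ λ α → All (𝒜 α ∪F ℬ) Xs) ⊎ All ℬ Xs
All-⋃-directed directed [] = inj₂ []
All-⋃-directed directed (inj₂ X∈ℬ ∷ Xs∈) =
  Sum.map (λ (α , Xs∈α) → α , inj₂ X∈ℬ ∷ Xs∈α) (X∈ℬ ∷_) (All-⋃-directed directed Xs∈)
All-⋃-directed directed (inj₁ (α , X∈𝒜α) ∷ Xs∈) with All-⋃-directed directed Xs∈
... | inj₂ Xs∈ℬ = inj₁ (α , inj₁ X∈𝒜α ∷ All.map inj₂ Xs∈ℬ)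
... | inj₁ (α′ , Xs∈α′) with directed α α′
...   | γ , α⊆γ , α′⊆γ = inj₁ (γ , inj₁ (α⊆γ _ X∈𝒜α) ∷ All-⊆F (λ X → Sum.map₁ (α′⊆γ X)) Xs∈α′)

module _ (em : ExcludedMiddle (suc 0ℓ)) {I : Set} (below𝔟 : BelowB I)
  (𝒜 : I → Family) (directed : Directed 𝒜) (hyp : ∀ α → ¬ EQSubbaseOfContour (𝒜 α))
  (W : ℕ → Subset) (partition : IsPartition W) (e : ℕ → Subset)
  (sfip : SFIP (⋃ 𝒜 ∪F Range e)) (∫⊆ : ∫ W ⊆F ⟨ ⋃ 𝒜 ∪F Range e ⟩) where

  private
    e⁺ : ℕ → Subset
    e⁺ = interleave e (tail W)

    sfip⁺ : SFIP (⋃ 𝒜 ∪F Range e⁺)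
    sfip⁺ = SFIP-antitone (λ X → Sum.assocˡ ∘ Sum.map₂ (Range-interleave⁻ e (tail W) X))
                          (SFIP-∪ tails∈⟨⟩ sfip)
      where
      tails∈⟨⟩ : Range (tail W) ⊆F ⟨ ⋃ 𝒜 ∪F Range e ⟩
      tails∈⟨⟩ _ (k , refl) = ∫⊆ _ (tail∈∫ k)

    escape : ∀ α → Σ Subset λ X → ∫ W X × ¬ ⟨ 𝒜 α ∪F Range e⁺ ⟩ X
    escape α = ¬⊆F⇒witness em λ ∫⊆α →
      hyp α (W , partition , e⁺ , SFIP-antitone (λ X → Sum.map₁ (α ,_)) sfip⁺ , ∫⊆α)

    threshold : ∀ α → ∃ λ N → Σ (ℕ → ℕ) λ f → Threshold W (proj₁ (escape α)) N f
    threshold α = ∫-threshold (proj₁ (proj₂ (escape α)))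

    dominating : ∃ λ g → ∀ α → proj₁ (proj₂ (threshold α)) ≤* g
    dominating = below𝔟 (λ α → proj₁ (proj₂ (threshold α)))

    g : ℕ → ℕ
    g = proj₁ dominating

    point : ℕ → ℕ
    point k = proj₁ (⋂≤-nonempty (SFIP-antitone (λ _ → inj₂) sfip⁺) (1+ (double k)))

    point∈⋂≤ : ∀ k → ⋂≤ e⁺ (1+ (double k)) (point k)
    point∈⋂≤ k = proj₂ (⋂≤-nonempty (SFIP-antitone (λ _ → inj₂) sfip⁺) (1+ (double k)))

    point∈tail : ∀ k → tail W k (point k)
    point∈tail k = subst (λ Z → Z (point k)) (interleave-1+double e (tail W) k) (point∈⋂≤ k _ ≤-refl)

    Y : Subset
    Y = Above W g ∩ Missed point

    not-countable : ∀ {Xs} → All (Range e⁺) Xs → ¬ (⋂ Xs ⊆ Y)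
    not-countable Xs∈ ⋂Xs⊆Y =
      let (j , ⋂≤⊆) = All-Range⇒⋂≤ Xs∈
          j≤ = ≤-trans (n≤double j) (n≤1+n _)
      in proj₂ (⋂Xs⊆Y _ (⋂≤⊆ _ (⋂≤-antitone e⁺ j≤ _ (point∈⋂≤ j)))) j refl

    not-at-stage : ∀ α {Xs} → All (𝒜 α ∪F Range e⁺) Xs → ¬ (⋂ Xs ⊆ Y)
    not-at-stage α {Xs} Xs∈ ⋂Xs⊆Y =
      let (N , f , N-f-threshold) = threshold α
          (K , captured) = Threshold-capture N-f-threshold (proj₂ dominating α)
      in proj₂ (proj₂ (escape α))
           ( tail W K ∷ Xs , inj₂ (Range-interleaveʳ e (tail W) _ (K , refl)) ∷ Xs∈
           , λ m (m∈tail , m∈⋂Xs) → captured m (m∈tail , proj₁ (⋂Xs⊆Y m m∈⋂Xs)))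

  directed-⋃-contradiction : ⊥
  directed-⋃-contradiction
    with ∫⊆ Y (Above∩Missed∈∫ partition g point point∈tail)
  ... | Xs , Xs∈ , ⋂Xs⊆Y
    with All-⋃-directed directed (All-⊆F (λ X → Sum.map₂ (Range-interleaveˡ e (tail W) X)) Xs∈)
  ... | inj₁ (α , Xs∈α) = not-at-stage α Xs∈α ⋂Xs⊆Y
  ... | inj₂ Xs∈e⁺ = not-countable Xs∈e⁺ ⋂Xs⊆Y

¬EQSubbaseOfContour-⋃ : ExcludedMiddle (suc 0ℓ) → ∀ {I} → BelowB I → (𝒜 : I → Family) →
  Directed 𝒜 → (∀ α → ¬ EQSubbaseOfContour (𝒜 α)) → ¬ EQSubbaseOfContour (⋃ 𝒜)
¬EQSubbaseOfContour-⋃ em below𝔟 𝒜 directed hyp (W , partition , e , sfip , ∫⊆) =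
  directed-⋃-contradiction em below𝔟 𝒜 directed hyp W partition e sfip ∫⊆

theorem1 : ExcludedMiddle (suc 0ℓ) →
    (β : Ordinal) → BelowB (Ordinal.Carrier β) →
    (𝒜 : Ordinal.Carrier β → Family) →
    (∀ α α′ → Ordinal._<_ β α α′ → 𝒜 α ⊆F 𝒜 α′) →
    (∀ α → ¬ EQSubbaseOfContour (𝒜 α)) →
    ¬ EQSubbaseOfContour (λ X → ∃ λ α → 𝒜 α X)
theorem1 em β below𝔟 𝒜 mono = ¬EQSubbaseOfContour-⋃ em below𝔟 𝒜 (chain-directed β 𝒜 mono)
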